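{- Let $k\in\mathbb{Z}$ with $k\equiv \pm4 \pmod{12}$. Then $$\operatorname{Ker}\nu_{\eta^{2k}}=\left\{M\in\Gamma(1)\;\Big|\;M\equiv\pm\begin{pmatrix} 1&0\\ 0&1\end{pmatrix},\pm\begin{pmatrix} 0&-1\\ 1&0\end{pmatrix},\pm\begin{pmatrix} 1&1\\ 1&-1\end{pmatrix},\pm\begin{pmatrix} -1&1\\ 1&1\end{pmatrix}\pmod 3\right\}.$$ Moreover, the matrices $S^n$ $(0\le n\le 2)$, where $S=\begin{pmatrix} 1&1\\ 0&1\end{pmatrix}$, form a complete set of coset representatives of $\Gamma(1)$ modulo $\operatorname{Ker}\nu_{\eta^{2k}}$.
   Context: Let $\Gamma(1)=SL(2,\mathbb{Z})$, acting on the upper half plane $\mathscr{H}=\{\tau\in\mathbb{C}:\Im\tau>0\}$ by $M\tau=\frac{a\tau+b}{c\tau+d}$ for $M=\begin{pmatrix} a&b\\ c&d\end{pmatrix}$. Let $\eta(\tau)=q^{1/24}\prod_{n\ge1}(1-q^n)$ with $q=e^{2\pi i\tau}$ and $q^{1/24}=e^{2\pi i\tau/24}$. For $m\in\mathbb{Z}$, the multiplier system $\nu_{\eta^{2m}}:\Gamma(1)\to\mathbb{C}^\times$ is defined by $\eta^{2m}(M\tau)=\nu_{\eta^{2m}}(M)(c\tau+d)^m\eta^{2m}(\tau)$ for all $\tau\in\mathscr{H}$; it is a character of $\Gamma(1)$, given explicitly by $\nu_{\eta^{2m}}(M)=\exp\{\frac{m\pi i}{6}f(M)\}$, where $f(M)=(a+d)c-bd(c^2-1)-3c$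 if $c$ is odd and $f(M)=(a+d)c-bd(c^2-1)+3d-3-3cd$ if $c$ is even. $\operatorname{Ker}\nu_{\eta^{2m}}$ denotes its kernel. Congruences between integer matrices are entrywise. -}

module Defs where

open import Data.Nat using (ℕ; zero; suc)
import Data.Nat as N
open import Data.Bool using (Bool; if_then_else_)
open import Data.Integer using (ℤ; +_; _+_; _-_; _*_; -_; _%ℕ_)
open import Data.Integer.Divisibility using (_∣_)
open import Data.Sum using (_⊎_)
open import Data.Product using (_×_)
open import Relation.Binary.PropositionalEquality using (_≡_)

record Mat : Set where
  constructor mat
  field
    a b c d : ℤ
open Mat public

det : Mat → ℤ
det (mat a b c d) = a * d - b * c

InΓ1 : Mat → Set
InΓ1 M = det M ≡ + 1

_·_ : Mat → Mat → Mat
mat a b c d · mat a' b' c' d' =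
  mat (a * a' + b * c') (a * b' + b * d') (c * a' + d * c') (c * b' + d * d')

inv : Mat → Mat
inv (mat a b c d) = mat d (- b) (- c) a

I₂ : Mat
I₂ = mat (+ 1) (+ 0) (+ 0) (+ 1)

S : Mat
S = mat (+ 1) (+ 1) (+ 0) (+ 1)

_^_ : Mat → ℕ → Mat
M ^ zero = I₂
M ^ suc n = M · (M ^ n)

neg : Mat → Mat
neg (mat a b c d) = mat (- a) (- b) (- c) (- d)

isOdd : ℤ → Bool
isOdd c = (c %ℕ 2) N.≡ᵇ 1

-- the function f(M) from the explicit formula for ν_{η^{2m}}
f : Mat → ℤ
f (mat a b c d) =
  if isOdd c
  then (a + d) * c - b * d * (c * c - + 1) - + 3 * c
  else (a + d) * c - b * d * (c * c - + 1) + + 3 * d - + 3 - + 3 * c * d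

-- ν_{η^{2m}}(M) = exp(2πi · (m f(M)) / 12); we record the exponent m·f(M) (mod 12).
νexp : ℤ → Mat → ℤ
νexp m M = m * f M

InKer : ℤ → Mat → Set
InKer m M = InΓ1 M × (+ 12 ∣ νexp m M)

_≡[_]_ : Mat → ℤ → Mat → Set
mat a b c d ≡[ n ] mat a' b' c' d' =
  (n ∣ (a - a')) × (n ∣ (b - b')) × (n ∣ (c - c')) × (n ∣ (d - d'))

_≡±[_]_ : Mat → ℤ → Mat → Set
M ≡±[ n ] A = (M ≡[ n ] A) ⊎ (M ≡[ n ] neg A)

A₁ A₂ A₃ A₄ : Mat
A₁ = I₂
A₂ = mat (+ 0) (- + 1) (+ 1) (+ 0)
A₃ = mat (+ 1) (+ 1) (+ 1) (- + 1)
A₄ = mat (- + 1) (+ 1) (+ 1) (+ 1)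

CongCond : Mat → Set
CongCond M = (M ≡±[ + 3 ] A₁) ⊎ (M ≡±[ + 3 ] A₂) ⊎ (M ≡±[ + 3 ] A₃) ⊎ (M ≡±[ + 3 ] A₄)

-- Since k ≡ ±4 (mod 12), 12 divides k·x exactly when 3 divides x, so M lies in the kernel
-- iff f(M) ≡ 0 (mod 3). Modulo 3 the parity-dependent terms of f vanish, leaving the
-- polynomial (a + d)c − bd(c² − 1) in the entries; hence kernel membership, the congruence
-- condition and the coset test against S⁰, S¹, S² all depend only on M mod 3, and the theorem
-- reduces to a finite check over the 3⁴ residue matrices.
module Submission where

open import Defs
open import Data.Nat using (zero; suc)
import Data.Nat as ℕ
open import Data.Nat.Divisibility using () renaming (_∣_ to _∣ℕ_; _∣?_ to _∣ℕ?_)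
open import Data.Integer using (ℤ; +_; _+_; _-_; _*_; -_; ∣_∣; _%ℕ_; _/ℕ_)
open import Data.Integer.Divisibility using (_∣_; *-monoʳ-∣; *-cancelˡ-∣)
open import Data.Integer.Divisibility.Signed as Signed
  using (∣ᵤ⇒∣; ∣⇒∣ᵤ; ∣m∣n⇒∣m+n; ∣m⇒∣-m; ∣m⇒∣m*n; ∣n⇒∣m*n)
open import Data.Integer.DivMod using (a≡a%ℕn+[a/ℕn]*n; n%ℕd<d)
open import Data.Integer.Properties using (abs-*; +-identityʳ)
open import Data.Integer.Tactic.RingSolver using (solve-∀)
open import Data.Fin using (Fin; toℕ; fromℕ<; _≟_)
open import Data.Fin.Properties using (all?; any?; toℕ-fromℕ<)
open import Data.Bool using (true; false)
open import Data.Sum using (_⊎_; inj₁; inj₂)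
import Data.Sum as Sum
open import Data.Product using (_×_; _,_; ∃; proj₁; proj₂; map₂)
open import Function using (_∘_)
open import Function.Bundles using (_⇔_; mk⇔; Equivalence)
open import Function.Construct.Composition using (_⇔-∘_)
open import Relation.Binary.PropositionalEquality using (_≡_; refl; sym; trans; cong; cong₂; subst)
open import Relation.Nullary using (Dec)
open import Relation.Nullary.Decidable using (map′; True; toWitness; _×-dec_; _⊎-dec_; _→-dec_)

infix 4 _∣?_

_∣?_ : ∀ k x → Dec (k ∣ x)
k ∣? x = ∣ k ∣ ∣ℕ? ∣ x ∣

module Congruence (m : ℤ) where

  infix 4 _≋_ _≋?_ _≋ᴹ_

  record _≋_ (x y : ℤ) : Set where
    constructor ≋-intro
    field divides-difference : m ∣ x - y

  open _≋_ public

  ≋-from-difference : ∀ {x y e} → x - y ≡ e → m Signed.∣ e → x ≋ y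
  ≋-from-difference x-y≡e = ≋-intro ∘ ∣⇒∣ᵤ ∘ subst (m Signed.∣_) (sym x-y≡e)

  private
    toSigned : ∀ {x y} → x ≋ y → m Signed.∣ x - y
    toSigned = ∣ᵤ⇒∣ ∘ divides-difference

  _≋?_ : ∀ x y → Dec (x ≋ y)
  x ≋? y = map′ ≋-intro divides-difference (m ∣? (x - y))

  ≋-reflexive : ∀ {x y} → x ≡ y → x ≋ y
  ≋-reflexive {x} refl = ≋-from-difference (x-x≡0 x) (Signed.divides (+ 0) refl)
    where
    x-x≡0 : ∀ x → x - x ≡ + 0
    x-x≡0 = solve-∀

  ≋-refl : ∀ {x} → x ≋ x
  ≋-refl = ≋-reflexive refl

  ≋-sym : ∀ {x y} → x ≋ y → y ≋ x
  ≋-sym {x} {y} p = ≋-from-difference (y-x≡-[x-y] x y) (∣m⇒∣-m (toSigned p))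
    where
    y-x≡-[x-y] : ∀ x y → y - x ≡ - (x - y)
    y-x≡-[x-y] = solve-∀

  ≋-trans : ∀ {x y z} → x ≋ y → y ≋ z → x ≋ z
  ≋-trans {x} {y} {z} p q = ≋-from-difference (x-z≡[x-y]+[y-z] x y z) (∣m∣n⇒∣m+n (toSigned p) (toSigned q))
    where
    x-z≡[x-y]+[y-z] : ∀ x y z → x - z ≡ (x - y) + (y - z)
    x-z≡[x-y]+[y-z] = solve-∀

  +-cong : ∀ {x y u v} → x ≋ y → u ≋ v → x + u ≋ y + v
  +-cong {x} {y} {u} {v} p q = ≋-from-difference (identity x y u v) (∣m∣n⇒∣m+n (toSigned p) (toSigned q))
    where
    identity : ∀ x y u v → (x + u) - (y + v) ≡ (x - y) + (u - v)
    identity = solve-∀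

  neg-cong : ∀ {x y} → x ≋ y → - x ≋ - y
  neg-cong {x} {y} p = ≋-from-difference (identity x y) (∣m⇒∣-m (toSigned p))
    where
    identity : ∀ x y → - x - - y ≡ - (x - y)
    identity = solve-∀

  -‿cong : ∀ {x y u v} → x ≋ y → u ≋ v → x - u ≋ y - v
  -‿cong p q = +-cong p (neg-cong q)

  *-cong : ∀ {x y u v} → x ≋ y → u ≋ v → x * u ≋ y * v
  *-cong {x} {y} {u} {v} p q =
    ≋-from-difference (identity x y u v) (∣m∣n⇒∣m+n (∣m⇒∣m*n u (toSigned p)) (∣n⇒∣m*n y (toSigned q)))
    where
    identity : ∀ x y u v → x * u - y * v ≡ (x - y) * u + y * (u - v)
    identity = solve-∀

  ∣⇔≋0 : ∀ x → (m ∣ x) ⇔ (x ≋ + 0)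
  ∣⇔≋0 x = mk⇔ (≋-intro ∘ subst (m ∣_) (sym (+-identityʳ x))) (subst (m ∣_) (+-identityʳ x) ∘ divides-difference)

  ∣-respʳ-≋ : ∀ {x y} → x ≋ y → m ∣ x → m ∣ y
  ∣-respʳ-≋ {x} {y} x≋y = from (∣⇔≋0 y) ∘ ≋-trans (≋-sym x≋y) ∘ to (∣⇔≋0 x)
    where open Equivalence

  record _≋ᴹ_ (M N : Mat) : Set where
    constructor ≋ᴹ-intro
    field
      a-≋ : a M ≋ a N
      b-≋ : b M ≋ b N
      c-≋ : c M ≋ c N
      d-≋ : d M ≋ d N

  ≋ᴹ-refl : ∀ {M} → M ≋ᴹ M
  ≋ᴹ-refl = ≋ᴹ-intro ≋-refl ≋-refl ≋-refl ≋-refl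

  ≋ᴹ-sym : ∀ {M N} → M ≋ᴹ N → N ≋ᴹ M
  ≋ᴹ-sym (≋ᴹ-intro p q r s) = ≋ᴹ-intro (≋-sym p) (≋-sym q) (≋-sym r) (≋-sym s)

  ·-cong : ∀ {M M′ N N′} → M ≋ᴹ M′ → N ≋ᴹ N′ → M · N ≋ᴹ M′ · N′
  ·-cong (≋ᴹ-intro a≋ b≋ c≋ d≋) (≋ᴹ-intro a≋′ b≋′ c≋′ d≋′) = ≋ᴹ-intro
    (+-cong (*-cong a≋ a≋′) (*-cong b≋ c≋′)) (+-cong (*-cong a≋ b≋′) (*-cong b≋ d≋′))
    (+-cong (*-cong c≋ a≋′) (*-cong d≋ c≋′)) (+-cong (*-cong c≋ b≋′) (*-cong d≋ d≋′))

  det-cong : ∀ {M N} → M ≋ᴹ N → det M ≋ det N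
  det-cong (≋ᴹ-intro a≋ b≋ c≋ d≋) = -‿cong (*-cong a≋ d≋) (*-cong b≋ c≋)

  ≡[]-respˡ-≋ᴹ : ∀ {M N} A → M ≋ᴹ N → N ≡[ m ] A → M ≡[ m ] A
  ≡[]-respˡ-≋ᴹ A (≋ᴹ-intro a≋ b≋ c≋ d≋) (p , q , r , s) =
    divides-difference (≋-trans a≋ (≋-intro p)) , divides-difference (≋-trans b≋ (≋-intro q)) ,
    divides-difference (≋-trans c≋ (≋-intro r)) , divides-difference (≋-trans d≋ (≋-intro s))

  ≡±[]-respˡ-≋ᴹ : ∀ {M N} A → M ≋ᴹ N → N ≡±[ m ] A → M ≡±[ m ] A
  ≡±[]-respˡ-≋ᴹ A M≋N = Sum.map (≡[]-respˡ-≋ᴹ A M≋N) (≡[]-respˡ-≋ᴹ (neg A) M≋N)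

  _≡[]?_ : ∀ M A → Dec (M ≡[ m ] A)
  M ≡[]? A = m ∣? (a M - a A) ×-dec m ∣? (b M - b A) ×-dec m ∣? (c M - c A) ×-dec m ∣? (d M - d A)

  _≡±[]?_ : ∀ M A → Dec (M ≡±[ m ] A)
  M ≡±[]? A = (M ≡[]? A) ⊎-dec (M ≡[]? neg A)

module Mod12 = Congruence (+ 12)
open Congruence (+ 3)

det-· : ∀ M N → det (M · N) ≡ det M * det N
det-· M N = identity (a M) (b M) (c M) (d M) (a N) (b N) (c N) (d N)
  where
  identity : ∀ a b c d a′ b′ c′ d′ →
    (a * a′ + b * c′) * (c * b′ + d * d′) - (a * b′ + b * d′) * (c * a′ + d * c′)
      ≡ (a * d - b * c) * (a′ * d′ - b′ * c′)
  identity = solve-∀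

det-inv : ∀ M → det (inv M) ≡ det M
det-inv M = identity (a M) (b M) (c M) (d M)
  where
  identity : ∀ a b c d → d * a - (- b) * (- c) ≡ a * d - b * c
  identity = solve-∀

InΓ1-· : ∀ M N → InΓ1 M → InΓ1 N → InΓ1 (M · N)
InΓ1-· M N M∈Γ N∈Γ = trans (det-· M N) (cong₂ _*_ M∈Γ N∈Γ)

InΓ1-inv : ∀ M → InΓ1 M → InΓ1 (inv M)
InΓ1-inv M M∈Γ = trans (det-inv M) M∈Γ

InΓ1-^ : ∀ M n → InΓ1 M → InΓ1 (M ^ n)
InΓ1-^ M zero M∈Γ = refl
InΓ1-^ M (suc n) M∈Γ = InΓ1-· M (M ^ n) M∈Γ (InΓ1-^ M n M∈Γ)

12∣k*x⇔3∣x : ∀ k ε → k Mod12.≋ ε → ∣ ε ∣ ≡ 4 → ∀ x → (+ 12 ∣ k * x) ⇔ (+ 3 ∣ x)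
12∣k*x⇔3∣x k ε k≋ε ∣ε∣≡4 x = mk⇔
  (*-cancelˡ-∣ (+ 4) {+ 3} {x} ∘ subst (12 ∣ℕ_) ∣εx∣≡∣4x∣ ∘ Mod12.∣-respʳ-≋ kx≋εx)
  (Mod12.∣-respʳ-≋ (Mod12.≋-sym kx≋εx) ∘ subst (12 ∣ℕ_) (sym ∣εx∣≡∣4x∣) ∘ *-monoʳ-∣ (+ 4) {+ 3} {x})
  where
  kx≋εx : k * x Mod12.≋ ε * x
  kx≋εx = Mod12.*-cong k≋ε Mod12.≋-refl
  ∣εx∣≡∣4x∣ : ∣ ε * x ∣ ≡ ∣ + 4 * x ∣
  ∣εx∣≡∣4x∣ = trans (abs-* ε x) (trans (cong (ℕ._* ∣ x ∣) ∣ε∣≡4) (sym (abs-* (+ 4) x)))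

k≡±4⇒12∣k*x⇔3∣x : ∀ k → (+ 12 ∣ k - + 4) ⊎ (+ 12 ∣ k + + 4) → ∀ x → (+ 12 ∣ k * x) ⇔ (+ 3 ∣ x)
k≡±4⇒12∣k*x⇔3∣x k (inj₁ 12∣k-4) = 12∣k*x⇔3∣x k (+ 4) (Mod12.≋-intro 12∣k-4) refl
k≡±4⇒12∣k*x⇔3∣x k (inj₂ 12∣k+4) = 12∣k*x⇔3∣x k (- + 4) (Mod12.≋-intro 12∣k+4) refl

-- f(M) without its parity-dependent multiple of 3.
f₀ : Mat → ℤ
f₀ M = (a M + d M) * c M - b M * d M * (c M * c M - + 1)

f≋f₀ : ∀ M → f M ≋ f₀ M
f≋f₀ (mat a b c d) with isOdd c
... | true  = ≋-from-difference (odd a b c d) (Signed.divides (- c) refl)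
  where
  odd : ∀ a b c d → (a + d) * c - b * d * (c * c - + 1) - + 3 * c - ((a + d) * c - b * d * (c * c - + 1))
                     ≡ - c * + 3
  odd = solve-∀
... | false = ≋-from-difference (even a b c d) (Signed.divides (d - + 1 - c * d) refl)
  where
  even : ∀ a b c d → (a + d) * c - b * d * (c * c - + 1) + + 3 * d - + 3 - + 3 * c * d
                        - ((a + d) * c - b * d * (c * c - + 1))
                      ≡ (d - + 1 - c * d) * + 3
  even = solve-∀

f₀-cong : ∀ {M N} → M ≋ᴹ N → f₀ M ≋ f₀ N
f₀-cong (≋ᴹ-intro a≋ b≋ c≋ d≋) =
  -‿cong (*-cong (+-cong a≋ d≋) c≋) (*-cong (*-cong b≋ d≋) (-‿cong (*-cong c≋ c≋) ≋-refl))

InKer⇔f₀≋0 : ∀ k → (∀ x → (+ 12 ∣ k * x) ⇔ (+ 3 ∣ x)) → ∀ M → InΓ1 M → InKer k M ⇔ (f₀ M ≋ + 0)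
InKer⇔f₀≋0 k 12∣k*_⇔3∣_ M M∈Γ = mk⇔
  (λ (_ , 12∣kf) → ≋-trans (≋-sym (f≋f₀ M)) (to (∣⇔≋0 (f M)) (to (12∣k*_⇔3∣_ (f M)) 12∣kf)))
  (λ f₀≋0 → M∈Γ , from (12∣k*_⇔3∣_ (f M)) (from (∣⇔≋0 (f M)) (≋-trans (f≋f₀ M) f₀≋0)))
  where open Equivalence

congCond-respˡ : ∀ {M N} → M ≋ᴹ N → CongCond N → CongCond M
congCond-respˡ M≋N =
  Sum.map (≡±[]-respˡ-≋ᴹ A₁ M≋N) (Sum.map (≡±[]-respˡ-≋ᴹ A₂ M≋N)
    (Sum.map (≡±[]-respˡ-≋ᴹ A₃ M≋N) (≡±[]-respˡ-≋ᴹ A₄ M≋N)))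

congCond? : ∀ M → Dec (CongCond M)
congCond? M = M ≡±[]? A₁ ⊎-dec M ≡±[]? A₂ ⊎-dec M ≡±[]? A₃ ⊎-dec M ≡±[]? A₄

residue : ℤ → Fin 3
residue x = fromℕ< (n%ℕd<d x 3)

≋-residue : ∀ x → x ≋ + toℕ (residue x)
≋-residue x rewrite toℕ-fromℕ< (n%ℕd<d x 3) =
  ≋-from-difference (trans (cong (_- r) (a≡a%ℕn+[a/ℕn]*n x 3)) (identity r (x /ℕ 3 * + 3))) (Signed.divides (x /ℕ 3) refl)
  where
  r = + (x %ℕ 3)
  identity : ∀ r q → (r + q) - r ≡ q
  identity = solve-∀

residueMatrix : (x y z w : Fin 3) → Mat
residueMatrix x y z w = mat (+ toℕ x) (+ toℕ y) (+ toℕ z) (+ toℕ w)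

≋ᴹ-residueMatrix : ∀ M → M ≋ᴹ residueMatrix (residue (a M)) (residue (b M)) (residue (c M)) (residue (d M))
≋ᴹ-residueMatrix M = ≋ᴹ-intro (≋-residue (a M)) (≋-residue (b M)) (≋-residue (c M)) (≋-residue (d M))

byResidues : {P : Mat → Set} (P? : ∀ M → Dec (P M)) →
  {True (all? λ x → all? λ y → all? λ z → all? λ w → P? (residueMatrix x y z w))} →
  (∀ {M N} → M ≋ᴹ N → P N → P M) → ∀ M → P M
byResidues P? {all-residues} resp M =
  resp (≋ᴹ-residueMatrix M) (toWitness all-residues (residue (a M)) (residue (b M)) (residue (c M)) (residue (d M)))

f₀≋0⇔congCond : ∀ M → det M ≋ + 1 → (f₀ M ≋ + 0 → CongCond M) × (CongCond M → f₀ M ≋ + 0)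
f₀≋0⇔congCond = byResidues
  (λ M → det M ≋? + 1 →-dec ((f₀ M ≋? + 0 →-dec congCond? M) ×-dec (congCond? M →-dec f₀ M ≋? + 0)))
  resp
  where
  resp : ∀ {M N} → M ≋ᴹ N →
    (det N ≋ + 1 → (f₀ N ≋ + 0 → CongCond N) × (CongCond N → f₀ N ≋ + 0)) →
    (det M ≋ + 1 → (f₀ M ≋ + 0 → CongCond M) × (CongCond M → f₀ M ≋ + 0))
  resp M≋N equivN detM≋1 =
    (λ f₀M≋0 → congCond-respˡ M≋N (to (≋-trans (≋-sym (f₀-cong M≋N)) f₀M≋0))) ,
    (λ congM → ≋-trans (f₀-cong M≋N) (from (congCond-respˡ (≋ᴹ-sym M≋N) congM)))
    where
    detN≋1 = ≋-trans (≋-sym (det-cong M≋N)) detM≋1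
    to = proj₁ (equivN detN≋1)
    from = proj₂ (equivN detN≋1)

S-coset-mod3 : ∀ M → det M ≋ + 1 → ∃ λ (n : Fin 3) → f₀ (inv (S ^ toℕ n) · M) ≋ + 0
S-coset-mod3 = byResidues
  (λ M → det M ≋? + 1 →-dec any? λ n → f₀ (inv (S ^ toℕ n) · M) ≋? + 0)
  resp
  where
  resp : ∀ {M N} → M ≋ᴹ N →
    (det N ≋ + 1 → ∃ λ (n : Fin 3) → f₀ (inv (S ^ toℕ n) · N) ≋ + 0) →
    (det M ≋ + 1 → ∃ λ (n : Fin 3) → f₀ (inv (S ^ toℕ n) · M) ≋ + 0)
  resp M≋N cosetN detM≋1 =
    map₂ (λ {n} → ≋-trans (f₀-cong (·-cong (≋ᴹ-refl {inv (S ^ toℕ n)}) M≋N)))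
      (cosetN (≋-trans (≋-sym (det-cong M≋N)) detM≋1))

S-powers-distinct-mod3 : ∀ (i j : Fin 3) → f₀ (inv (S ^ toℕ i) · (S ^ toℕ j)) ≋ + 0 → i ≡ j
S-powers-distinct-mod3 =
  toWitness {a? = all? λ i → all? λ j → f₀ (inv (S ^ toℕ i) · (S ^ toℕ j)) ≋? + 0 →-dec i ≟ j} _

mainTheorem5 : (k : ℤ) → ((+ 12 ∣ (k - + 4)) ⊎ (+ 12 ∣ (k + + 4))) →
    ((M : Mat) → InΓ1 M → (InKer k M ⇔ CongCond M))
    × ((M : Mat) → InΓ1 M → ∃ λ (n : Fin 3) → InKer k (inv (S ^ toℕ n) · M))
    × ((i j : Fin 3) → InKer k (inv (S ^ toℕ i) · (S ^ toℕ j)) → i ≡ j)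
mainTheorem5 k k≡±4 = kernel , cosetRepresentative , representativesDistinct
  where
  InKer⇔ : ∀ M → InΓ1 M → InKer k M ⇔ (f₀ M ≋ + 0)
  InKer⇔ = InKer⇔f₀≋0 k (k≡±4⇒12∣k*x⇔3∣x k k≡±4)

  kernel : ∀ M → InΓ1 M → InKer k M ⇔ CongCond M
  kernel M M∈Γ =
    let (to , from) = f₀≋0⇔congCond M (≋-reflexive M∈Γ) in mk⇔ to from ⇔-∘ InKer⇔ M M∈Γ

  cosetRepresentative : ∀ M → InΓ1 M → ∃ λ (n : Fin 3) → InKer k (inv (S ^ toℕ n) · M)
  cosetRepresentative M M∈Γ =
    map₂ (λ {n} → Equivalence.from (InKer⇔ (inv (S ^ toℕ n) · M) (N∈Γ n))) (S-coset-mod3 M (≋-reflexive M∈Γ))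
    where
    N∈Γ : ∀ n → InΓ1 (inv (S ^ toℕ n) · M)
    N∈Γ n = InΓ1-· (inv (S ^ toℕ n)) M (InΓ1-inv (S ^ toℕ n) (InΓ1-^ S (toℕ n) refl)) M∈Γ

  representativesDistinct : ∀ i j → InKer k (inv (S ^ toℕ i) · (S ^ toℕ j)) → i ≡ j
  representativesDistinct i j inKer@(N∈Γ , _) =
    S-powers-distinct-mod3 i j (Equivalence.to (InKer⇔ (inv (S ^ toℕ i) · (S ^ toℕ j)) N∈Γ) inKer)
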